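{- Let $G$ be a $K_{2,3}$-saturated graph and let $\alpha_1, \alpha_2$ be distinct nonadjacent vertices of $G$. Then there exist $i \in \{1,2\}$ and a vertex $b \in N(\alpha_i)$ such that $|N(\alpha_{3-i}) \cap N(b)| \geq 2$.
   Context: All graphs are finite and simple; $N(x)$ denotes the set of neighbors of a vertex $x$. A graph $G$ is $K_{2,3}$-saturated if it contains no subgraph isomorphic to $K_{2,3}$, but adding any edge between two nonadjacent vertices creates a subgraph isomorphic to $K_{2,3}$. -}

module Defs where

open import Data.Nat using (ℕ)
open import Data.Fin using (Fin)
open import Data.Product using (Σ; _×_; _,_; ∃)
open import Data.Sum using (_⊎_)
open import Relation.Nullary using (¬_; Dec)
open import Relation.Binary.PropositionalEquality using (_≡_)
open import Level using (0ℓ; suc)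

record Graph (n : ℕ) : Set₁ where
  field
    Adj     : Fin n → Fin n → Set
    adj?    : ∀ x y → Dec (Adj x y)
    sym     : ∀ {x y} → Adj x y → Adj y x
    irrefl  : ∀ {x} → ¬ Adj x x
open Graph public

AddEdge : ∀ {n} → Graph n → Fin n → Fin n → Fin n → Fin n → Set
AddEdge G u v x y = Adj G x y ⊎ ((x ≡ u × y ≡ v) ⊎ (x ≡ v × y ≡ u))

ContainsK23 : ∀ {n} → (Fin n → Fin n → Set) → Set
ContainsK23 {n} E =
  Σ (Fin n) λ a₁ → Σ (Fin n) λ a₂ → Σ (Fin n) λ b₁ → Σ (Fin n) λ b₂ → Σ (Fin n) λ b₃ →
    (¬ a₁ ≡ a₂) × (¬ a₁ ≡ b₁) × (¬ a₁ ≡ b₂) × (¬ a₁ ≡ b₃) ×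
    (¬ a₂ ≡ b₁) × (¬ a₂ ≡ b₂) × (¬ a₂ ≡ b₃) ×
    (¬ b₁ ≡ b₂) × (¬ b₁ ≡ b₃) × (¬ b₂ ≡ b₃) ×
    E a₁ b₁ × E a₁ b₂ × E a₁ b₃ × E a₂ b₁ × E a₂ b₂ × E a₂ b₃

K23Saturated : ∀ {n} → Graph n → Set
K23Saturated {n} G =
  (¬ ContainsK23 (Adj G)) ×
  (∀ (u v : Fin n) → ¬ u ≡ v → ¬ Adj G u v → ContainsK23 (AddEdge G u v))

AtLeastTwoCommonNbrs : ∀ {n} → Graph n → Fin n → Fin n → Set
AtLeastTwoCommonNbrs {n} G x y =
  Σ (Fin n) λ c → Σ (Fin n) λ d →
    (¬ c ≡ d) × Adj G x c × Adj G y c × Adj G x d × Adj G y d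

module Submission where

-- Adding the missing edge α₁α₂ creates a K_{2,3}, which must use the new edge, say as
-- a b with a = α₁ and b = α₂ (or the other way round). The second vertex a' of a's side
-- is then adjacent to b = α₂ in G, and the two remaining vertices of b's side are
-- common neighbours of a = α₁ and a' in G; so a' is the required vertex.

open import Defs hiding (sym)
open import Data.Nat using (ℕ)
open import Data.Fin using (Fin; zero; suc; punchIn)
open import Data.Fin.Properties using (all?; ¬∀⟶∃¬; punchInᵢ≢i; punchIn-injective)
open import Data.Product using (Σ; ∃₂; _×_; _,_)
open import Data.Sum using (_⊎_; inj₁; inj₂; [_,_]′; map₂; swap)
open import Data.Empty using (⊥-elim)
open import Function using (_∘_; id)
open import Function.Definitions using (Injective)
open import Relation.Nullary using (¬_; Dec; yes; no)
open import Relation.Binary.PropositionalEquality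
  using (_≡_; _≢_; refl; sym; trans; subst; ≢-sym)

-- A copy of K_{2,3} in an adjacency relation, with its sides indexed by Fin 2 and Fin 3.
-- Unlike ContainsK23 it does not ask the two sides to be disjoint: for an irreflexive
-- relation this follows from the edges.
record K23 {n : ℕ} (E : Fin n → Fin n → Set) : Set where
  field
    left            : Fin 2 → Fin n
    right           : Fin 3 → Fin n
    left-injective  : Injective _≡_ _≡_ left
    right-injective : Injective _≡_ _≡_ right
    edge            : ∀ i j → E (left i) (right j)

module _ {n : ℕ} {E E′ : Fin n → Fin n → Set} where

  K23-sameVertices : (K : K23 E) → (∀ i j → E′ (K23.left K i) (K23.right K j)) → K23 E′
  K23-sameVertices K edge′ = record
    { left = left ; right = right
    ; left-injective = left-injective ; right-injective = right-injective
    ; edge = edge′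
    }
    where open K23 K

  K23-map : (∀ {x y} → E x y → E′ x y) → K23 E → K23 E′
  K23-map E⇒E′ K = K23-sameVertices K (λ i j → E⇒E′ (K23.edge K i j))

pattern one = suc zero
pattern two = suc one

module _ {n : ℕ} {E : Fin n → Fin n → Set} where

  ends-distinct : (∀ {x} → ¬ E x x) → ∀ {x y} → E x y → x ≢ y
  ends-distinct irr e refl = irr e

  ContainsK23⇒K23 : ContainsK23 E → K23 E
  ContainsK23⇒K23 (a₁ , a₂ , b₁ , b₂ , b₃ , a₁≢a₂ , _ , _ , _ , _ , _ , _ ,
                   b₁≢b₂ , b₁≢b₃ , b₂≢b₃ , e₁₁ , e₁₂ , e₁₃ , e₂₁ , e₂₂ , e₂₃) =
    record { left = a ; right = b ; left-injective = a-inj ; right-injective = b-inj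
           ; edge = e }
    where
    a : Fin 2 → Fin n
    a zero = a₁
    a one  = a₂

    b : Fin 3 → Fin n
    b zero = b₁
    b one  = b₂
    b two  = b₃

    a-inj : Injective _≡_ _≡_ a
    a-inj {zero} {zero} _  = refl
    a-inj {zero} {one}  eq = ⊥-elim (a₁≢a₂ eq)
    a-inj {one}  {zero} eq = ⊥-elim (a₁≢a₂ (sym eq))
    a-inj {one}  {one}  _  = refl

    b-inj : Injective _≡_ _≡_ b
    b-inj {zero} {zero} _  = refl
    b-inj {zero} {one}  eq = ⊥-elim (b₁≢b₂ eq)
    b-inj {zero} {two}  eq = ⊥-elim (b₁≢b₃ eq)
    b-inj {one}  {zero} eq = ⊥-elim (b₁≢b₂ (sym eq))
    b-inj {one}  {one}  _  = refl
    b-inj {one}  {two}  eq = ⊥-elim (b₂≢b₃ eq)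
    b-inj {two}  {zero} eq = ⊥-elim (b₁≢b₃ (sym eq))
    b-inj {two}  {one}  eq = ⊥-elim (b₂≢b₃ (sym eq))
    b-inj {two}  {two}  _  = refl

    e : ∀ i j → E (a i) (b j)
    e zero zero = e₁₁
    e zero one  = e₁₂
    e zero two  = e₁₃
    e one  zero = e₂₁
    e one  one  = e₂₂
    e one  two  = e₂₃

  K23⇒ContainsK23 : (∀ {x} → ¬ E x x) → K23 E → ContainsK23 E
  K23⇒ContainsK23 irr K =
    left zero , left one , right zero , right one , right two ,
    left-distinct {zero} {one} (λ ()) ,
    distinct zero zero , distinct zero one , distinct zero two ,
    distinct one zero , distinct one one , distinct one two ,
    right-distinct {zero} {one} (λ ()) ,
    right-distinct {zero} {two} (λ ()) ,
    right-distinct {one} {two} (λ ()) ,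
    edge zero zero , edge zero one , edge zero two ,
    edge one zero , edge one one , edge one two
    where
    open K23 K
    left-distinct : ∀ {i i′} → i ≢ i′ → left i ≢ left i′
    left-distinct i≢i′ = i≢i′ ∘ left-injective
    right-distinct : ∀ {j j′} → j ≢ j′ → right j ≢ right j′
    right-distinct j≢j′ = j≢j′ ∘ right-injective
    distinct : ∀ i j → left i ≢ right j
    distinct i j = ends-distinct irr (edge i j)

NewEdge : ∀ {n} → Fin n → Fin n → Fin n → Fin n → Set
NewEdge u v x y = (x ≡ u × y ≡ v) ⊎ (x ≡ v × y ≡ u)

module _ {n : ℕ} (G : Graph n) {u v : Fin n} where

  AddEdge-comm : ∀ {x y} → AddEdge G u v x y → AddEdge G v u x y
  AddEdge-comm = map₂ swap

  AddEdge-irrefl : u ≢ v → ∀ {x} → ¬ AddEdge G u v x x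
  AddEdge-irrefl u≢v (inj₁ e)                = irrefl G e
  AddEdge-irrefl u≢v (inj₂ (inj₁ (refl , x≡v))) = u≢v x≡v
  AddEdge-irrefl u≢v (inj₂ (inj₂ (refl , x≡u))) = u≢v (sym x≡u)

  AddEdge⇒Adj-leftAway : ∀ {x y} → x ≢ u → x ≢ v → AddEdge G u v x y → Adj G x y
  AddEdge⇒Adj-leftAway _   _   (inj₁ e)                = e
  AddEdge⇒Adj-leftAway x≢u _   (inj₂ (inj₁ (x≡u , _))) = ⊥-elim (x≢u x≡u)
  AddEdge⇒Adj-leftAway _   x≢v (inj₂ (inj₂ (x≡v , _))) = ⊥-elim (x≢v x≡v)

  AddEdge⇒Adj-rightAway : ∀ {x y} → y ≢ u → y ≢ v → AddEdge G u v x y → Adj G x y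
  AddEdge⇒Adj-rightAway _   _   (inj₁ e)                = e
  AddEdge⇒Adj-rightAway _   y≢v (inj₂ (inj₁ (_ , y≡v))) = ⊥-elim (y≢v y≡v)
  AddEdge⇒Adj-rightAway y≢u _   (inj₂ (inj₂ (_ , y≡u))) = ⊥-elim (y≢u y≡u)

  K23-newEdge : ¬ K23 (Adj G) → (K : K23 (AddEdge G u v)) →
    ∃₂ λ i j → NewEdge u v (K23.left K i) (K23.right K j)
  K23-newEdge K23-free K = locate (all? old?)
    where
    open K23 K

    old? : ∀ i → Dec (∀ j → Adj G (left i) (right j))
    old? i = all? (λ j → adj? G (left i) (right j))

    locate : Dec (∀ i j → Adj G (left i) (right j)) →
      ∃₂ λ i j → NewEdge u v (left i) (right j)
    locate (yes old) = ⊥-elim (K23-free (K23-sameVertices K old))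
    locate (no ¬old) =
      let i , ¬oldᵢ = ¬∀⟶∃¬ 2 _ old? ¬old
          j , ¬adj  = ¬∀⟶∃¬ 3 _ (λ j → adj? G (left i) (right j)) ¬oldᵢ
      in i , j , [ ⊥-elim ∘ ¬adj , id ]′ (edge i j)

  K23-newEdge⇒commonNbrs : u ≢ v → (K : K23 (AddEdge G u v)) → ∀ {i j} →
    K23.left K i ≡ u → K23.right K j ≡ v →
    Σ (Fin n) λ b → Adj G v b × AtLeastTwoCommonNbrs G u b
  K23-newEdge⇒commonNbrs u≢v K {i} {j} leftᵢ≡u rightⱼ≡v =
    partner , Graph.sym G partner∼v ,
    right c , right d , c≢d ∘ right-injective ,
    u∼ c≢j , partner∼ c≢j , u∼ d≢j , partner∼ d≢j
    where
    open K23 K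

    ends≢ : ∀ {x y} → AddEdge G u v x y → x ≢ y
    ends≢ = ends-distinct {E = AddEdge G u v} (AddEdge-irrefl u≢v)

    partner : Fin n
    partner = left (punchIn i zero)

    partner≢u : partner ≢ u
    partner≢u eq = punchInᵢ≢i i zero (left-injective (trans eq (sym leftᵢ≡u)))

    partner≢v : partner ≢ v
    partner≢v eq = ends≢ (edge (punchIn i zero) j) (trans eq (sym rightⱼ≡v))

    partner∼v : Adj G partner v
    partner∼v = subst (Adj G partner) rightⱼ≡v
      (AddEdge⇒Adj-leftAway partner≢u partner≢v (edge (punchIn i zero) j))

    c d : Fin 3
    c = punchIn j zero
    d = punchIn j one

    c≢j : c ≢ j
    c≢j = punchInᵢ≢i j zero

    d≢j : d ≢ j
    d≢j = punchInᵢ≢i j one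

    c≢d : c ≢ d
    c≢d eq with punchIn-injective j zero one eq
    ... | ()

    module _ {j′ : Fin 3} (j′≢j : j′ ≢ j) where
      right≢v : right j′ ≢ v
      right≢v eq = j′≢j (right-injective (trans eq (sym rightⱼ≡v)))

      right≢u : right j′ ≢ u
      right≢u eq = ends≢ (edge i j′) (trans leftᵢ≡u (sym eq))

      u∼ : Adj G u (right j′)
      u∼ = subst (λ x → Adj G x (right j′)) leftᵢ≡u
        (AddEdge⇒Adj-rightAway right≢u right≢v (edge i j′))

      partner∼ : Adj G partner (right j′)
      partner∼ = AddEdge⇒Adj-rightAway right≢u right≢v (edge (punchIn i zero) j′)

proposition3p1 : ∀ {n : ℕ} (G : Graph n) → K23Saturated G →
    (α₁ α₂ : Fin n) → ¬ α₁ ≡ α₂ → ¬ Adj G α₁ α₂ →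
    (Σ (Fin n) λ b → Adj G α₁ b × AtLeastTwoCommonNbrs G α₂ b)
    ⊎ (Σ (Fin n) λ b → Adj G α₂ b × AtLeastTwoCommonNbrs G α₁ b)
proposition3p1 G (K23-free , saturated) α₁ α₂ α₁≢α₂ α₁≁α₂
  with K ← ContainsK23⇒K23 (saturated α₁ α₂ α₁≢α₂ α₁≁α₂)
  with K23-newEdge G (K23-free ∘ K23⇒ContainsK23 (irrefl G)) K
... | _ , _ , inj₁ (leftᵢ≡α₁ , rightⱼ≡α₂) =
  inj₂ (K23-newEdge⇒commonNbrs G α₁≢α₂ K leftᵢ≡α₁ rightⱼ≡α₂)
... | _ , _ , inj₂ (leftᵢ≡α₂ , rightⱼ≡α₁) =
  inj₁ (K23-newEdge⇒commonNbrs G (≢-sym α₁≢α₂) (K23-map (AddEdge-comm G) K) leftᵢ≡α₂ rightⱼ≡α₁)
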